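{- Let $\pi,\sigma$ be permutations of $[n]$, $\tau$ a type assignment and $\rho:[n]\to\mathbb{N}$ a pile assignment function. The heterogeneous shuffle of $\pi$ with $(\tau,\rho)$ equals $\sigma$ if and only if $(\tau,\rho\circ\sigma^{ -1})$ sorts $\pi\circ\sigma^{ -1}$.
   Context: A deck of cards labelled by $[n]$ is represented by a permutation $\pi$ of $[n]$ with $\pi(s)$ the position (from the top) of label $s$. Label $s$ is dealt to the $\rho(s)$-th pile collected; pile $p$ has type $\tau(p)\in\{\mathrm{Q},\mathrm{S}\}$ (queue preserves placement order, stack reverses it). With $\chi(p)=[\tau(p)=\mathrm{S}]$, the heterogeneous shuffle of $\pi$ with $(\tau,\rho)$ is the unique permutation $\sigma$ of $[n]$ with $\sigma(s)<\sigma(t)$ iff $\big(\rho(s),(-1)^{\chi(\rho(s))}\pi(s)\big)<\big(\rho(t),(-1)^{\chi(\rho(t))}\pi(t)\big)$ lexicographically; $(\tau,\rho)$ sorts a permutation if the shuffle yields the identity. $f\circ g$ denotes composition. -}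

module Defs where

open import Data.Nat using (ℕ; _<_)
open import Data.Integer as ℤ using (ℤ; +_; -_)
open import Data.Fin using (Fin; toℕ)
open import Data.Fin.Permutation using (Permutation′; _⟨$⟩ʳ_; id)
open import Data.Product using (_×_)
open import Data.Sum using (_⊎_)
open import Function.Bundles using (_⇔_)
open import Relation.Binary.PropositionalEquality using (_≡_)

-- Pile types: queue (preserves order) or stack (reverses order).
data PileType : Set where
  Q S : PileType

-- A type assignment: the type τ(p) of the p-th pile collected.
TypeAssignment : Set
TypeAssignment = ℕ → PileType

signed : PileType → ℕ → ℤ
signed Q x = + x
signed S x = - (+ x)

_<lex_ : ℕ × ℤ → ℕ × ℤ → Set
(a Data.Product., x) <lex (b Data.Product., y) = (a < b) ⊎ ((a ≡ b) × (x ℤ.< y))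

-- The sort key of label s: (ρ(s), (-1)^{χ(ρ(s))} π(s)).  Positions are
-- 0-based here (toℕ); this only shifts all π-values by one and does not
-- affect the lexicographic comparison.
key : {n : ℕ} → Permutation′ n → TypeAssignment → (Fin n → ℕ) → Fin n → ℕ × ℤ
key π τ ρ s = ρ s Data.Product., signed (τ (ρ s)) (toℕ (π ⟨$⟩ʳ s))

-- "The heterogeneous shuffle of π with (τ,ρ) equals σ": σ is the (unique)
-- permutation with σ(s) < σ(t) iff key(s) <lex key(t).
IsHetShuffle : {n : ℕ} → Permutation′ n → TypeAssignment → (Fin n → ℕ) → Permutation′ n → Set
IsHetShuffle π τ ρ σ =
  ∀ s t → (toℕ (σ ⟨$⟩ʳ s) < toℕ (σ ⟨$⟩ʳ t)) ⇔ (key π τ ρ s <lex key π τ ρ t)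

Sorts : {n : ℕ} → TypeAssignment → (Fin n → ℕ) → Permutation′ n → Set
Sorts τ ρ π = IsHetShuffle π τ ρ id

{-# OPTIONS --safe #-}
module Submission where

open import Defs
open import Data.Nat using (ℕ; _<_)
open import Data.Fin using (Fin; toℕ)
open import Data.Fin.Permutation
  using (Permutation; Permutation′; _⟨$⟩ʳ_; _⟨$⟩ˡ_; _∘ₚ_; flip; inverseˡ; inverseʳ)
open import Function using (_∘_)
open import Function.Bundles using (_⇔_; mk⇔)
open import Level using (Level)
open import Relation.Binary.PropositionalEquality using (subst₂)

private
  variable
    a b : Level
    m n : ℕ

relabel-⇔ : (σ : Permutation m n) {R : Fin n → Fin n → Set a} {P : Fin m → Fin m → Set b} →
  (∀ s t → R (σ ⟨$⟩ʳ s) (σ ⟨$⟩ʳ t) ⇔ P s t) ⇔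
  (∀ s t → R s t ⇔ P (σ ⟨$⟩ˡ s) (σ ⟨$⟩ˡ t))
relabel-⇔ σ {R} {P} = mk⇔ forward backward
  where
  forward : (∀ s t → R (σ ⟨$⟩ʳ s) (σ ⟨$⟩ʳ t) ⇔ P s t) →
            ∀ s t → R s t ⇔ P (σ ⟨$⟩ˡ s) (σ ⟨$⟩ˡ t)
  forward h s t =
    subst₂ (λ x y → R x y ⇔ P (σ ⟨$⟩ˡ s) (σ ⟨$⟩ˡ t))
      (inverseʳ σ) (inverseʳ σ) (h (σ ⟨$⟩ˡ s) (σ ⟨$⟩ˡ t))

  backward : (∀ s t → R s t ⇔ P (σ ⟨$⟩ˡ s) (σ ⟨$⟩ˡ t)) →
             ∀ s t → R (σ ⟨$⟩ʳ s) (σ ⟨$⟩ʳ t) ⇔ P s t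
  backward h s t =
    subst₂ (λ x y → R (σ ⟨$⟩ʳ s) (σ ⟨$⟩ʳ t) ⇔ P x y)
      (inverseˡ σ) (inverseˡ σ) (h (σ ⟨$⟩ʳ s) (σ ⟨$⟩ʳ t))

-- The key of label s for (τ, ρ ∘ σ⁻¹) and π ∘ σ⁻¹ is, definitionally, the key of σ⁻¹ s
-- for (τ, ρ) and π, so the two sides are those of relabel-⇔.
corollary4 : (n : ℕ) (π σ : Permutation′ n) (τ : TypeAssignment) (ρ : Fin n → ℕ) →
    IsHetShuffle π τ ρ σ ⇔ Sorts τ (ρ ∘ (σ ⟨$⟩ˡ_)) (flip σ ∘ₚ π)
corollary4 n π σ τ ρ =
  relabel-⇔ σ {R = λ s t → toℕ s < toℕ t} {P = λ s t → key π τ ρ s <lex key π τ ρ t}
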